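{- Let $s,k,n$ be natural numbers with $s\le n$ and $k\le n$, and write $\mathcal Q_{s,k,n}=\sum_\lambda c_\lambda\, t_{\lambda_1}\cdots t_{\lambda_d}$, the sum over integer partitions $\lambda=(\lambda_1\ge\dots\ge\lambda_d\ge1)$ of $k$. If $c_\lambda\neq0$, then the number $d$ of parts of $\lambda$ satisfies $d\le s$.
   Context: For a multiset $A=\{a_1,\dots,a_n\}$ of $n$ complex numbers, $\mathfrak p_j(A)=\sum_{i=1}^n a_i^j$, and for $s\le n$, $A^{(s)}$ denotes the multiset of all $\binom ns$ sums $a_{i_1}+\dots+a_{i_s}$ with $1\le i_1<\dots<i_s\le n$ (with multiplicity). For $s,k\le n$, $\mathcal Q_{s,k,n}(t_1,\dots,t_k)$ is the unique polynomial with rational coefficients such that for every $n$-multiset $A$ of complex numbers, $\mathfrak p_k(A^{(s)})=\mathcal Q_{s,k,n}(\mathfrak p_1(A),\dots,\mathfrak p_k(A))$. -}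

module Defs where

open import Data.Nat using (ℕ; zero; suc; _≤_)
open import Data.Rational using (ℚ; 0ℚ; 1ℚ; _+_; _*_)
open import Data.List using (List; []; _∷_; map; _++_; foldr)
open import Data.List.Relation.Unary.All using (All)
open import Data.List.Relation.Unary.Linked using (Linked)
open import Data.Product using (_×_; _,_; proj₁; proj₂)
open import Relation.Binary.PropositionalEquality using (_≡_)
open import Data.Nat using (_≥_)

_^ℚ_ : ℚ → ℕ → ℚ
x ^ℚ zero = 1ℚ
x ^ℚ suc j = x * (x ^ℚ j)

sumℚ : List ℚ → ℚ
sumℚ = foldr _+_ 0ℚ

productℚ : List ℚ → ℚ
productℚ = foldr _*_ 1ℚ

sumℕ : List ℕ → ℕ
sumℕ = foldr Data.Nat._+_ 0

-- power sum 𝔭_j(A) of a multiset A (given as a list, with multiplicity)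
powerSum : ℕ → List ℚ → ℚ
powerSum j A = sumℚ (map (_^ℚ j) A)

-- A^{(s)}: the multiset of all sums a_{i_1}+…+a_{i_s}, i_1<…<i_s
-- (one entry per s-element index subset, hence with multiplicity)
subsetSums : ℕ → List ℚ → List ℚ
subsetSums zero    _        = 0ℚ ∷ []
subsetSums (suc s) []       = []
subsetSums (suc s) (a ∷ as) = map (a +_) (subsetSums s as) ++ subsetSums (suc s) as

IsPartition : ℕ → List ℕ → Set
IsPartition k λs = (sumℕ λs ≡ k) × All (1 ≤_) λs × Linked _≥_ λs

monomialAt : List ℕ → List ℚ → ℚ
monomialAt λs A = productℚ (map (λ j → powerSum j A) λs)

-- a polynomial Σ_λ c_λ t_{λ₁}⋯t_{λ_d}, given as a list of (c_λ , λ),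
-- evaluated at t_j = 𝔭_j(A)
evalQ : List (ℚ × List ℕ) → List ℚ → ℚ
evalQ Q A = sumℚ (map (λ cl → proj₁ cl * monomialAt (proj₂ cl) A) Q)

-- Take a nonzero term c·t_ℓ with the largest number D of parts and suppose
-- D > s.  Apply to both sides the mixed difference operator Δ in D of the variables
-- (the others set to 0), which keeps exactly the part of a function depending on all
-- D variables:
--  * every element of A^{(s)} involves only s < D entries, so the left side dies;
--  * Δ sends a monomial t_ν to the surjection polynomial Σ x₁^{ΣJ₁}⋯x_D^{ΣJ_D} over
--    ordered partitions of ν into D nonempty blocks; it is 0 unless ν has ≥ D parts.
-- Substituting x_i = y^{B^{i-1}} with B = k + 1 makes the exponent of each term the
-- number with digits ΣJ₁,…,ΣJ_D in base B.  For the exponent E spelling ℓ only ℓ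
-- itself contributes, with a positive count, so comparing coefficients of y^E in the
-- identically vanishing polynomial forces c = 0.  A descending induction on the
-- maximal number of parts then gives the corollary.

module Submission where

open import Defs
open import Data.Nat as ℕ using (ℕ; zero; suc; _≤_; _<_; s≤s; z≤n; _∸_)
import Data.Nat.Properties as ℕP
open import Data.Rational as ℚ using (ℚ; 0ℚ; 1ℚ; _+_; _*_; _-_; -_)
import Data.Rational.Properties as ℚP
open import Data.Rational.Solver using (module +-*-Solver)
open import Data.List using (List; []; _∷_; map; _++_; length; concatMap; concat; replicate)
import Data.List.Properties as ListP
open import Data.List.Relation.Unary.All as All using (All; []; _∷_)
import Data.List.Relation.Unary.All.Properties as AllP
open import Data.List.Relation.Unary.Any using (here; there)
open import Data.List.Relation.Unary.AllPairs using (_∷_)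
open import Data.List.Relation.Unary.Linked using (Linked)
open import Data.List.Relation.Unary.Unique.Propositional using (Unique)
open import Data.List.Membership.Propositional using (_∈_)
open import Data.List.Membership.Propositional.Properties using (∈-map⁺; ∈-++⁺ʳ; ∈-concat⁺′)
open import Data.List.Relation.Binary.Permutation.Propositional using (_↭_; ↭-sym; ↭-trans; ↭-prep; ↭-refl; ↭⇒↭ₛ)
open import Data.List.Relation.Binary.Permutation.Propositional.Properties using (shift)
open import Data.List.Relation.Unary.Sorted.TotalOrder.Properties using (↗↭↗⇒≋)
open import Data.List.Relation.Binary.Equality.Propositional using (≋⇒≡)
import Relation.Binary.Construct.Flip.EqAndOrd as Flip
open import Data.Vec using (Vec; toList; fromList)
import Data.Vec.Properties as VecP
open import Data.Product using (_×_; _,_; proj₁; proj₂)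
open import Data.Empty using (⊥-elim)
open import Function using (_∘_)
open import Relation.Nullary using (yes; no)
open import Relation.Binary.Definitions using (tri<; tri≈; tri>)
open import Relation.Binary.PropositionalEquality

open +-*-Solver using (solve; _:+_; _:*_; _:-_; _:=_; con)
open ≡-Reasoning

sum-++ : (xs ys : List ℚ) → sumℚ (xs ++ ys) ≡ sumℚ xs + sumℚ ys
sum-++ []       ys = sym (ℚP.+-identityˡ _)
sum-++ (x ∷ xs) ys = trans (cong (x +_) (sum-++ xs ys)) (sym (ℚP.+-assoc x _ _))

module _ {A : Set} where

  sum-map-++ : (f : A → ℚ) (xs ys : List A) →
    sumℚ (map f (xs ++ ys)) ≡ sumℚ (map f xs) + sumℚ (map f ys)
  sum-map-++ f xs ys = trans (cong sumℚ (ListP.map-++ f xs ys)) (sum-++ (map f xs) (map f ys))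

  sum-cong : {f g : A → ℚ} (xs : List A) → (∀ a → f a ≡ g a) →
    sumℚ (map f xs) ≡ sumℚ (map g xs)
  sum-cong []       h = refl
  sum-cong (x ∷ xs) h = cong₂ _+_ (h x) (sum-cong xs h)

  sum-congᴬ : {f g : A → ℚ} (xs : List A) → All (λ a → f a ≡ g a) xs →
    sumℚ (map f xs) ≡ sumℚ (map g xs)
  sum-congᴬ []       []       = refl
  sum-congᴬ (x ∷ xs) (p ∷ ps) = cong₂ _+_ p (sum-congᴬ xs ps)

  sum-zero : (f : A → ℚ) (xs : List A) → All (λ a → f a ≡ 0ℚ) xs → sumℚ (map f xs) ≡ 0ℚ
  sum-zero f []       []       = refl
  sum-zero f (x ∷ xs) (p ∷ ps) = trans (cong₂ _+_ p (sum-zero f xs ps)) (ℚP.+-identityˡ 0ℚ)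

  sum-scale : (c : ℚ) (f : A → ℚ) (xs : List A) →
    sumℚ (map (λ a → c * f a) xs) ≡ c * sumℚ (map f xs)
  sum-scale c f []       = sym (ℚP.*-zeroʳ c)
  sum-scale c f (x ∷ xs) =
    trans (cong (c * f x +_) (sum-scale c f xs)) (sym (ℚP.*-distribˡ-+ c _ _))

module _ {A B : Set} where

  sum-map-∘ : (f : B → ℚ) (g : A → B) (xs : List A) →
    sumℚ (map f (map g xs)) ≡ sumℚ (map (λ a → f (g a)) xs)
  sum-map-∘ f g []       = refl
  sum-map-∘ f g (x ∷ xs) = cong (f (g x) +_) (sum-map-∘ f g xs)

  sum-concatMap : (f : B → ℚ) (g : A → List B) (xs : List A) →
    sumℚ (map f (concatMap g xs)) ≡ sumℚ (map (λ a → sumℚ (map f (g a))) xs)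
  sum-concatMap f g []       = refl
  sum-concatMap f g (x ∷ xs) =
    trans (sum-map-++ f (g x) (concat (map g xs)))
          (cong (sumℚ (map f (g x)) +_) (sum-concatMap f g xs))

-- For xs = (x₁,…,x_D),
--   Δ xs f = Σ_{S ⊆ {1..D}} (-1)^{D-|S|} f(xs with the entries outside S replaced by 0),
-- the D-fold iterate of  f ↦ f(x,…) - f(0,…).  It is linear in f, and it annihilates
-- every function that does not depend on all D arguments jointly.

Δ : List ℚ → (List ℚ → ℚ) → ℚ
Δ []       f = f []
Δ (x ∷ xs) f = Δ xs (λ L → f (x ∷ L)) - Δ xs (λ L → f (0ℚ ∷ L))

Δ-cong : ∀ xs (f g : List ℚ → ℚ) → (∀ L → length L ≡ length xs → f L ≡ g L) → Δ xs f ≡ Δ xs g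
Δ-cong []       f g h = h [] refl
Δ-cong (x ∷ xs) f g h = cong₂ _-_
  (Δ-cong xs _ _ (λ L e → h (x ∷ L) (cong suc e)))
  (Δ-cong xs _ _ (λ L e → h (0ℚ ∷ L) (cong suc e)))

Δ-+ : ∀ xs (f g : List ℚ → ℚ) → Δ xs (λ L → f L + g L) ≡ Δ xs f + Δ xs g
Δ-+ []       f g = refl
Δ-+ (x ∷ xs) f g = begin
  Δ xs (λ L → f (x ∷ L) + g (x ∷ L)) - Δ xs (λ L → f (0ℚ ∷ L) + g (0ℚ ∷ L))
    ≡⟨ cong₂ _-_ (Δ-+ xs _ _) (Δ-+ xs _ _) ⟩
  (a + b) - (c + d)
    ≡⟨ solve 4 (λ a b c d → (a :+ b) :- (c :+ d) := (a :- c) :+ (b :- d)) refl a b c d ⟩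
  (a - c) + (b - d) ∎
  where
  a = Δ xs (λ L → f (x ∷ L))
  b = Δ xs (λ L → g (x ∷ L))
  c = Δ xs (λ L → f (0ℚ ∷ L))
  d = Δ xs (λ L → g (0ℚ ∷ L))

Δ-scale : ∀ xs (c : ℚ) (f : List ℚ → ℚ) → Δ xs (λ L → c * f L) ≡ c * Δ xs f
Δ-scale []       c f = refl
Δ-scale (x ∷ xs) c f = begin
  Δ xs (λ L → c * f (x ∷ L)) - Δ xs (λ L → c * f (0ℚ ∷ L))
    ≡⟨ cong₂ _-_ (Δ-scale xs c _) (Δ-scale xs c _) ⟩
  c * a - c * b
    ≡⟨ solve 3 (λ c a b → c :* a :- c :* b := c :* (a :- b)) refl c a b ⟩
  c * (a - b) ∎
  where
  a = Δ xs (λ L → f (x ∷ L))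
  b = Δ xs (λ L → f (0ℚ ∷ L))

Δ-const0 : ∀ xs → Δ xs (λ _ → 0ℚ) ≡ 0ℚ
Δ-const0 []       = refl
Δ-const0 (x ∷ xs) = cong₂ _-_ (Δ-const0 xs) (Δ-const0 xs)

Δ-sum : ∀ {A : Set} xs (h : List ℚ → A → ℚ) (as : List A) →
  Δ xs (λ L → sumℚ (map (h L) as)) ≡ sumℚ (map (λ a → Δ xs (λ L → h L a)) as)
Δ-sum xs h []       = Δ-const0 xs
Δ-sum xs h (a ∷ as) =
  trans (Δ-+ xs (λ L → h L a) (λ L → sumℚ (map (h L) as)))
        (cong (Δ xs (λ L → h L a) +_) (Δ-sum xs h as))

-- Key vanishing: every element of (L ++ z)^{(s)} is a sum of only s entries, so
-- any function g of it is annihilated by Δ over more than s entries L.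
-- (Induction: splitting off the first entry u, both halves of the recurrence for
-- subsetSums are killed, the first by the induction hypothesis for s-1 with
-- g shifted by u.)
Δ-subsetSums : ∀ xs s (z : List ℚ) (g : ℚ → ℚ) → s < length xs →
  Δ xs (λ L → sumℚ (map g (subsetSums s (L ++ z)))) ≡ 0ℚ
Δ-subsetSums (x ∷ xs) zero    z g _          = ℚP.+-inverseʳ (Δ xs (λ L → g 0ℚ + 0ℚ))
Δ-subsetSums (x ∷ xs) (suc s) z g (s≤s s<D) = begin
  Δ xs (F x) - Δ xs (F 0ℚ)  ≡⟨ cong₂ _-_ (firstEntry x) (firstEntry 0ℚ) ⟩
  (0ℚ + Y) - (0ℚ + Y)       ≡⟨ ℚP.+-inverseʳ (0ℚ + Y) ⟩
  0ℚ                        ∎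
  where
  F : ℚ → List ℚ → ℚ
  F u L = sumℚ (map g (subsetSums (suc s) (u ∷ L ++ z)))
  Y = Δ xs (λ L → sumℚ (map g (subsetSums (suc s) (L ++ z))))
  unfold : ∀ u M → sumℚ (map g (subsetSums (suc s) (u ∷ M))) ≡
    sumℚ (map (λ v → g (u + v)) (subsetSums s M)) + sumℚ (map g (subsetSums (suc s) M))
  unfold u M = trans (sum-map-++ g (map (u +_) (subsetSums s M)) (subsetSums (suc s) M))
                     (cong (_+ _) (sum-map-∘ g (u +_) (subsetSums s M)))
  firstEntry : ∀ u → Δ xs (F u) ≡ 0ℚ + Y
  firstEntry u = begin
    Δ xs (F u)
      ≡⟨ Δ-cong xs _ _ (λ L _ → unfold u (L ++ z)) ⟩
    Δ xs (λ L → sumℚ (map (λ v → g (u + v)) (subsetSums s (L ++ z)))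
              + sumℚ (map g (subsetSums (suc s) (L ++ z))))
      ≡⟨ Δ-+ xs _ _ ⟩
    Δ xs (λ L → sumℚ (map (λ v → g (u + v)) (subsetSums s (L ++ z)))) + Y
      ≡⟨ cong (_+ Y) (Δ-subsetSums xs s z (λ v → g (u + v)) s<D) ⟩
    0ℚ + Y ∎

^-+ : ∀ y a b → y ^ℚ (a ℕ.+ b) ≡ y ^ℚ a * y ^ℚ b
^-+ y zero    b = sym (ℚP.*-identityˡ _)
^-+ y (suc a) b = trans (cong (y *_) (^-+ y a b)) (sym (ℚP.*-assoc y _ _))

^-* : ∀ y B h → (y ^ℚ B) ^ℚ h ≡ y ^ℚ (B ℕ.* h)
^-* y B zero    = cong (y ^ℚ_) (sym (ℕP.*-zeroʳ B))
^-* y B (suc h) = begin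
  y ^ℚ B * (y ^ℚ B) ^ℚ h   ≡⟨ cong (y ^ℚ B *_) (^-* y B h) ⟩
  y ^ℚ B * y ^ℚ (B ℕ.* h)  ≡⟨ sym (^-+ y B (B ℕ.* h)) ⟩
  y ^ℚ (B ℕ.+ B ℕ.* h)     ≡⟨ cong (y ^ℚ_) (sym (ℕP.*-suc B h)) ⟩
  y ^ℚ (B ℕ.* suc h)       ∎

monomialAt-cong : ∀ ν (L M : List ℚ) → All (λ a → powerSum a L ≡ powerSum a M) ν →
  monomialAt ν L ≡ monomialAt ν M
monomialAt-cong []      L M []       = refl
monomialAt-cong (a ∷ ν) L M (p ∷ ps) = cong₂ _*_ p (monomialAt-cong ν L M ps)

powerSum-zeros : ∀ a m → powerSum (suc a) (replicate m 0ℚ) ≡ 0ℚ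
powerSum-zeros a zero    = refl
powerSum-zeros a (suc m) =
  trans (cong₂ _+_ (ℚP.*-zeroˡ (0ℚ ^ℚ a)) (powerSum-zeros a m)) (ℚP.+-identityˡ 0ℚ)

monomialAt-0∷ : ∀ ν L → All (1 ≤_) ν → monomialAt ν (0ℚ ∷ L) ≡ monomialAt ν L
monomialAt-0∷ ν L pos = monomialAt-cong ν (0ℚ ∷ L) L (All.map dropZero pos)
  where
  dropZero : ∀ {a} → 1 ≤ a → powerSum a (0ℚ ∷ L) ≡ powerSum a L
  dropZero {suc a} _ = trans (cong (_+ powerSum (suc a) L) (ℚP.*-zeroˡ (0ℚ ^ℚ a))) (ℚP.+-identityˡ _)

monomialAt-++zeros : ∀ ν L m → All (1 ≤_) ν → monomialAt ν (L ++ replicate m 0ℚ) ≡ monomialAt ν L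
monomialAt-++zeros ν L m pos = monomialAt-cong ν (L ++ replicate m 0ℚ) L (All.map dropZeros pos)
  where
  dropZeros : ∀ {a} → 1 ≤ a → powerSum a (L ++ replicate m 0ℚ) ≡ powerSum a L
  dropZeros {suc a} _ = begin
    powerSum (suc a) (L ++ replicate m 0ℚ)
      ≡⟨ sum-map-++ (_^ℚ suc a) L (replicate m 0ℚ) ⟩
    powerSum (suc a) L + powerSum (suc a) (replicate m 0ℚ)
      ≡⟨ cong (powerSum (suc a) L +_) (powerSum-zeros a m) ⟩
    powerSum (suc a) L + 0ℚ
      ≡⟨ ℚP.+-identityʳ _ ⟩
    powerSum (suc a) L ∎

data Split : List ℕ → List ℕ → List ℕ → Set where
  []   : Split [] [] []
  left  : ∀ {a ν J R} → Split ν J R → Split (a ∷ ν) (a ∷ J) R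
  right : ∀ {a ν J R} → Split ν J R → Split (a ∷ ν) J (a ∷ R)

data NonEmpty : List ℕ → Set where
  _∷_ : ∀ a J → NonEmpty (a ∷ J)

Splitting : Set
Splitting = List ℕ × List ℕ

toLeft toRight : ℕ → Splitting → Splitting
toLeft  a (J , R) = (a ∷ J , R)
toRight a (J , R) = (J , a ∷ R)

-- splits⁺ ν lists the splittings (J , R) of ν with J nonempty (one per choice of
-- positions); splits ν adds the splitting ([] , ν).
splits⁺ : List ℕ → List Splitting
splits⁺ []      = []
splits⁺ (a ∷ ν) = map (toRight a) (splits⁺ ν) ++ map (toLeft a) (([] , ν) ∷ splits⁺ ν)

splits : List ℕ → List Splitting
splits ν = ([] , ν) ∷ splits⁺ ν

IsSplitting⁺ : List ℕ → Splitting → Set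
IsSplitting⁺ ν (J , R) = Split ν J R × NonEmpty J

splits⁺-sound : ∀ ν → All (IsSplitting⁺ ν) (splits⁺ ν)
splits⁺-sound []      = []
splits⁺-sound (a ∷ ν) = AllP.++⁺
  (AllP.map⁺ (All.map (λ (sp , ne) → right sp , ne) (splits⁺-sound ν)))
  (AllP.map⁺ ((left (allRight ν) , (a ∷ [])) ∷ All.map (λ (sp , _) → left sp , (a ∷ _)) (splits⁺-sound ν)))
  where
  allRight : ∀ ν → Split ν [] ν
  allRight []      = []
  allRight (b ∷ ν) = right (allRight ν)

-- Expanding a monomial in the first variable:  with A = x ∷ L,
--   ∏_{a ∈ ν} (x^a + 𝔭_a(L)) = Σ_{(J , R) splitting of ν} x^{ΣJ} · ∏_{a ∈ R} 𝔭_a(L).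

splitTerm : ℚ → List ℚ → Splitting → ℚ
splitTerm x L (J , R) = x ^ℚ sumℕ J * monomialAt R L

monomialAt-∷ : ∀ x L ν → monomialAt ν (x ∷ L) ≡ sumℚ (map (splitTerm x L) (splits ν))
monomialAt-∷ x L []      = refl
monomialAt-∷ x L (a ∷ ν) = begin
  (xa + p) * monomialAt ν (x ∷ L)
    ≡⟨ cong ((xa + p) *_) (monomialAt-∷ x L ν) ⟩
  (xa + p) * (1ℚ * M + N)
    ≡⟨ solve 5 (λ xa p M N one → (xa :+ p) :* (one :* M :+ N)
                  := one :* (p :* M) :+ (p :* N :+ xa :* (one :* M :+ N))) refl xa p M N 1ℚ ⟩
  1ℚ * (p * M) + (p * N + xa * (1ℚ * M + N))
    ≡⟨ cong (1ℚ * (p * M) +_) (sym newSplits) ⟩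
  1ℚ * (p * M) + sumℚ (map (splitTerm x L) (map (toRight a) (splits⁺ ν) ++ map (toLeft a) (splits ν))) ∎
  where
  xa = x ^ℚ a
  p  = powerSum a L
  M  = monomialAt ν L
  N  = sumℚ (map (splitTerm x L) (splits⁺ ν))
  rightTerm : ∀ q → splitTerm x L (toRight a q) ≡ p * splitTerm x L q
  rightTerm (J , R) = solve 3 (λ u p m → u :* (p :* m) := p :* (u :* m)) refl (x ^ℚ sumℕ J) p (monomialAt R L)
  leftTerm : ∀ q → splitTerm x L (toLeft a q) ≡ xa * splitTerm x L q
  leftTerm (J , R) = trans (cong (_* monomialAt R L) (^-+ x a (sumℕ J))) (ℚP.*-assoc xa _ _)
  newSplits : sumℚ (map (splitTerm x L) (map (toRight a) (splits⁺ ν) ++ map (toLeft a) (splits ν)))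
              ≡ p * N + xa * (1ℚ * M + N)
  newSplits = begin
    sumℚ (map (splitTerm x L) (map (toRight a) (splits⁺ ν) ++ map (toLeft a) (splits ν)))
      ≡⟨ sum-map-++ (splitTerm x L) (map (toRight a) (splits⁺ ν)) (map (toLeft a) (splits ν)) ⟩
    sumℚ (map (splitTerm x L) (map (toRight a) (splits⁺ ν))) + sumℚ (map (splitTerm x L) (map (toLeft a) (splits ν)))
      ≡⟨ cong₂ _+_ (sum-map-∘ (splitTerm x L) (toRight a) (splits⁺ ν)) (sum-map-∘ (splitTerm x L) (toLeft a) (splits ν)) ⟩
    sumℚ (map (λ q → splitTerm x L (toRight a q)) (splits⁺ ν)) + sumℚ (map (λ q → splitTerm x L (toLeft a q)) (splits ν))
      ≡⟨ cong₂ _+_ (trans (sum-cong (splits⁺ ν) rightTerm) (sum-scale p (splitTerm x L) (splits⁺ ν)))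
                   (trans (sum-cong (splits ν) leftTerm) (sum-scale xa (splitTerm x L) (splits ν))) ⟩
    p * N + xa * (1ℚ * M + N) ∎

-- The surjection polynomial: for xs = (x₁,…,x_D),
--   surj xs ν = Σ x₁^{ΣJ₁} ⋯ x_D^{ΣJ_D}
-- over the ordered partitions of (the positions of) ν into D nonempty blocks J₁,…,J_D.
surj : List ℚ → List ℕ → ℚ
surj []       ν = monomialAt ν []
surj (x ∷ xs) ν = sumℚ (map (λ (J , R) → x ^ℚ sumℕ J * surj xs R) (splits⁺ ν))

split-All : ∀ {P : ℕ → Set} {ν J R} → Split ν J R → All P ν → All P R
split-All []         []       = []
split-All (left sp)  (p ∷ ps) = split-All sp ps
split-All (right sp) (p ∷ ps) = p ∷ split-All sp ps

-- The mixed difference of a monomial in power sums of positive degree keeps exactly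
-- the terms in which every variable occurs: it is the surjection polynomial.
Δ-monomialAt : ∀ xs ν → All (1 ≤_) ν → Δ xs (monomialAt ν) ≡ surj xs ν
Δ-monomialAt []       ν _   = refl
Δ-monomialAt (x ∷ xs) ν pos = begin
  Δ xs (λ L → monomialAt ν (x ∷ L)) - Δ xs (λ L → monomialAt ν (0ℚ ∷ L))
    ≡⟨ cong₂ _-_ withX (Δ-cong xs _ _ (λ L _ → monomialAt-0∷ ν L pos)) ⟩
  (Δ xs (monomialAt ν) + S) - Δ xs (monomialAt ν)
    ≡⟨ solve 2 (λ a t → (a :+ t) :- a := t) refl (Δ xs (monomialAt ν)) S ⟩
  S ∎
  where
  S = surj (x ∷ xs) ν
  blockTerm : ∀ {q} → IsSplitting⁺ ν q → Δ xs (λ L → splitTerm x L q) ≡ x ^ℚ sumℕ (proj₁ q) * surj xs (proj₂ q)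
  blockTerm {J , R} (sp , _) =
    trans (Δ-scale xs (x ^ℚ sumℕ J) (monomialAt R))
          (cong (x ^ℚ sumℕ J *_) (Δ-monomialAt xs R (split-All sp pos)))
  withX : Δ xs (λ L → monomialAt ν (x ∷ L)) ≡ Δ xs (monomialAt ν) + S
  withX = begin
    Δ xs (λ L → monomialAt ν (x ∷ L))
      ≡⟨ Δ-cong xs _ _ (λ L _ → monomialAt-∷ x L ν) ⟩
    Δ xs (λ L → 1ℚ * monomialAt ν L + sumℚ (map (splitTerm x L) (splits⁺ ν)))
      ≡⟨ Δ-+ xs _ _ ⟩
    Δ xs (λ L → 1ℚ * monomialAt ν L) + Δ xs (λ L → sumℚ (map (splitTerm x L) (splits⁺ ν)))
      ≡⟨ cong₂ _+_ (Δ-cong xs _ _ (λ L _ → ℚP.*-identityˡ _)) (Δ-sum xs (splitTerm x) (splits⁺ ν)) ⟩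
    Δ xs (monomialAt ν) + sumℚ (map (λ q → Δ xs (λ L → splitTerm x L q)) (splits⁺ ν))
      ≡⟨ cong (Δ xs (monomialAt ν) +_) (sum-congᴬ (splits⁺ ν) (All.map blockTerm (splits⁺-sound ν))) ⟩
    Δ xs (monomialAt ν) + S ∎

-- Kronecker substitution x_i = y^{B^{i-1}} turns the surjection polynomial into a
-- polynomial in one variable y whose exponents are base-B numbers with the block
-- sums as digits.

kronecker : ℕ → ℕ → ℚ → List ℚ
kronecker B zero    y = []
kronecker B (suc D) y = y ∷ kronecker B D (y ^ℚ B)

kronecker-length : ∀ B D y → length (kronecker B D y) ≡ D
kronecker-length B zero    y = refl
kronecker-length B (suc D) y = cong suc (kronecker-length B D (y ^ℚ B))

-- the number with base-B digits d = (d₀ , d₁ , …), least significant first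
baseValue : ℕ → List ℕ → ℕ
baseValue B []      = 0
baseValue B (a ∷ d) = a ℕ.+ B ℕ.* baseValue B d

-- blockSums D ν: the sequences (ΣJ₁ , … , ΣJ_D) of block sums of the ordered
-- partitions of ν into D nonempty blocks, one entry per partition.
blockSums : ℕ → List ℕ → List (List ℕ)
blockSums zero    []      = [] ∷ []
blockSums zero    (_ ∷ _) = []
blockSums (suc D) ν       = concatMap (λ (J , R) → map (sumℕ J ∷_) (blockSums D R)) (splits⁺ ν)

surj-kronecker : ∀ B D y ν →
  surj (kronecker B D y) ν ≡ sumℚ (map (λ d → y ^ℚ baseValue B d) (blockSums D ν))
surj-kronecker B zero    y []      = refl
surj-kronecker B zero    y (a ∷ ν) = ℚP.*-zeroˡ (monomialAt ν [])
surj-kronecker B (suc D) y ν       = begin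
  sumℚ (map (λ (J , R) → y ^ℚ sumℕ J * surj (kronecker B D (y ^ℚ B)) R) (splits⁺ ν))
    ≡⟨ sum-cong (splits⁺ ν) firstBlock ⟩
  sumℚ (map (λ (J , R) → sumℚ (map yPow (map (sumℕ J ∷_) (blockSums D R)))) (splits⁺ ν))
    ≡⟨ sym (sum-concatMap yPow (λ (J , R) → map (sumℕ J ∷_) (blockSums D R)) (splits⁺ ν)) ⟩
  sumℚ (map yPow (blockSums (suc D) ν)) ∎
  where
  yPow : List ℕ → ℚ
  yPow d = y ^ℚ baseValue B d
  firstBlock : ∀ q → y ^ℚ sumℕ (proj₁ q) * surj (kronecker B D (y ^ℚ B)) (proj₂ q) ≡
                     sumℚ (map yPow (map (sumℕ (proj₁ q) ∷_) (blockSums D (proj₂ q))))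
  firstBlock (J , R) = begin
    y ^ℚ sumℕ J * surj (kronecker B D (y ^ℚ B)) R
      ≡⟨ cong (y ^ℚ sumℕ J *_) (surj-kronecker B D (y ^ℚ B) R) ⟩
    y ^ℚ sumℕ J * sumℚ (map (λ d → (y ^ℚ B) ^ℚ baseValue B d) (blockSums D R))
      ≡⟨ sym (sum-scale (y ^ℚ sumℕ J) (λ d → (y ^ℚ B) ^ℚ baseValue B d) (blockSums D R)) ⟩
    sumℚ (map (λ d → y ^ℚ sumℕ J * (y ^ℚ B) ^ℚ baseValue B d) (blockSums D R))
      ≡⟨ sum-cong (blockSums D R) (λ d → trans (cong (y ^ℚ sumℕ J *_) (^-* y B (baseValue B d)))
                                              (sym (^-+ y (sumℕ J) (B ℕ.* baseValue B d)))) ⟩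
    sumℚ (map (λ d → yPow (sumℕ J ∷ d)) (blockSums D R))
      ≡⟨ sym (sum-map-∘ yPow (sumℕ J ∷_) (blockSums D R)) ⟩
    sumℚ (map yPow (map (sumℕ J ∷_) (blockSums D R))) ∎

split-sum : ∀ {ν J R} → Split ν J R → sumℕ J ℕ.+ sumℕ R ≡ sumℕ ν
split-sum []         = refl
split-sum {a ∷ ν} {a ∷ J} {R} (left sp) = trans (ℕP.+-assoc a (sumℕ J) (sumℕ R)) (cong (a ℕ.+_) (split-sum sp))
split-sum {a ∷ ν} {J} {a ∷ R} (right sp) = begin
  sumℕ J ℕ.+ (a ℕ.+ sumℕ R)  ≡⟨ ℕP.+-comm (sumℕ J) (a ℕ.+ sumℕ R) ⟩
  (a ℕ.+ sumℕ R) ℕ.+ sumℕ J  ≡⟨ ℕP.+-assoc a (sumℕ R) (sumℕ J) ⟩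
  a ℕ.+ (sumℕ R ℕ.+ sumℕ J)  ≡⟨ cong (a ℕ.+_) (trans (ℕP.+-comm (sumℕ R) (sumℕ J)) (split-sum sp)) ⟩
  a ℕ.+ sumℕ ν               ∎

split-length : ∀ {ν J R} → Split ν J R → length J ℕ.+ length R ≡ length ν
split-length []         = refl
split-length (left sp)  = cong suc (split-length sp)
split-length {J = J} {R = _ ∷ R} (right sp) =
  trans (ℕP.+-suc (length J) (length R)) (cong suc (split-length sp))

split-↭ : ∀ {ν J R} → Split ν J R → ν ↭ J ++ R
split-↭ []         = ↭-refl
split-↭ (left sp)  = ↭-prep _ (split-↭ sp)
split-↭ {a ∷ ν} {J} {a ∷ R} (right sp) = ↭-trans (↭-prep a (split-↭ sp)) (↭-sym (shift a J R))

data BlockSums : ℕ → List ℕ → List ℕ → Set where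
  []    : BlockSums 0 [] []
  block : ∀ {D ν J R d} → Split ν J R → NonEmpty J → BlockSums D R d →
          BlockSums (suc D) ν (sumℕ J ∷ d)

blockSums-sound : ∀ D ν → All (BlockSums D ν) (blockSums D ν)
blockSums-sound zero    []      = [] ∷ []
blockSums-sound zero    (_ ∷ _) = []
blockSums-sound (suc D) ν       = AllP.concat⁺ (AllP.map⁺ (All.map firstBlock (splits⁺-sound ν)))
  where
  firstBlock : ∀ {q} → IsSplitting⁺ ν q → All (BlockSums (suc D) ν) (map (sumℕ (proj₁ q) ∷_) (blockSums D (proj₂ q)))
  firstBlock {J , R} (sp , ne) = AllP.map⁺ (All.map (block sp ne) (blockSums-sound D R))

BlockSums-length : ∀ {D ν d} → BlockSums D ν d → length d ≡ D
BlockSums-length []               = refl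
BlockSums-length (block _ _ rest) = cong suc (BlockSums-length rest)

BlockSums-digits : ∀ {D ν d} → BlockSums D ν d → All (_≤ sumℕ ν) d
BlockSums-digits []                  = []
BlockSums-digits (block {J = J} {R} sp _ rest) =
    ℕP.≤-trans (ℕP.m≤m+n (sumℕ J) (sumℕ R)) (ℕP.≤-reflexive (split-sum sp))
  ∷ All.map (λ h → ℕP.≤-trans h (ℕP.≤-trans (ℕP.m≤n+m (sumℕ R) (sumℕ J)) (ℕP.≤-reflexive (split-sum sp))))
            (BlockSums-digits rest)

BlockSums-few : ∀ {D ν d} → BlockSums D ν d → D ≤ length ν
BlockSums-few []                                  = z≤n
BlockSums-few (block {J = a ∷ J} {R} sp _ rest) =
  ℕP.≤-trans (s≤s (BlockSums-few rest))
    (ℕP.≤-trans (s≤s (ℕP.m≤n+m (length R) (length J))) (ℕP.≤-reflexive (split-length sp)))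

-- with at least as many blocks as parts, every block is a singleton, so the
-- block sums are a rearrangement of the parts
BlockSums-↭ : ∀ {D ν d} → BlockSums D ν d → length ν ≤ D → ν ↭ d
BlockSums-↭ []                                              _   = ↭-refl
BlockSums-↭ (block {R = R} sp (a ∷ []) rest)               len =
  ↭-trans (split-↭ sp)
    (subst (λ x → a ∷ R ↭ x ∷ _) (sym (ℕP.+-identityʳ a))
      (↭-prep a (BlockSums-↭ rest (ℕP.≤-pred (subst (_≤ _) (sym (split-length sp)) len)))))
BlockSums-↭ (block {R = R} sp (a ∷ b ∷ J) rest)            len =
  ⊥-elim (ℕP.<-irrefl refl (ℕP.<-≤-trans (s≤s (ℕP.m≤n+m (length R) (length J)))
    (ℕP.≤-trans (ℕP.≤-pred (subst (_≤ _) (sym (split-length sp)) len)) (BlockSums-few rest))))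

blockSums-singletons : ∀ ν → ν ∈ blockSums (length ν) ν
blockSums-singletons []      = here refl
blockSums-singletons (a ∷ ν) = subst (λ x → x ∷ ν ∈ blockSums (length (a ∷ ν)) (a ∷ ν)) (ℕP.+-identityʳ a)
  (∈-concat⁺′ (∈-map⁺ (a ℕ.+ 0 ∷_) (blockSums-singletons ν))
     (∈-map⁺ (λ (J , R) → map (sumℕ J ∷_) (blockSums (length ν) R))
        (∈-++⁺ʳ (map (toRight a) (splits⁺ ν)) (here refl))))

sorted-↭⇒≡ : ∀ {xs ys : List ℕ} → Linked ℕ._≥_ xs → Linked ℕ._≥_ ys → xs ↭ ys → xs ≡ ys
sorted-↭⇒≡ sx sy p = ≋⇒≡ (↗↭↗⇒≋ (Flip.totalOrder ℕP.≤-totalOrder) sx sy (↭⇒↭ₛ p))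

length≤sum : ∀ ν → All (1 ≤_) ν → length ν ≤ sumℕ ν
length≤sum []      []       = z≤n
length≤sum (a ∷ ν) (p ∷ ps) = ℕP.+-mono-≤ p (length≤sum ν ps)

digit-<-mono : ∀ B a a' h h' → a < B → h < h' → a ℕ.+ B ℕ.* h < a' ℕ.+ B ℕ.* h'
digit-<-mono B a a' h h' a<B h<h' =
  ℕP.<-≤-trans (ℕP.+-monoˡ-< (B ℕ.* h) a<B)
    (ℕP.≤-trans (ℕP.≤-reflexive (sym (ℕP.*-suc B h)))
      (ℕP.≤-trans (ℕP.*-monoʳ-≤ B h<h') (ℕP.m≤n+m (B ℕ.* h') a')))

digit-injective : ∀ B a a' h h' → a < B → a' < B →
  a ℕ.+ B ℕ.* h ≡ a' ℕ.+ B ℕ.* h' → a ≡ a' × h ≡ h'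
digit-injective B a a' h h' a<B a'<B eq with ℕP.<-cmp h h'
... | tri< h<h' _ _ = ⊥-elim (ℕP.<-irrefl eq (digit-<-mono B a a' h h' a<B h<h'))
... | tri≈ _ refl _ = ℕP.+-cancelʳ-≡ (B ℕ.* h) a a' eq , refl
... | tri> _ _ h'<h = ⊥-elim (ℕP.<-irrefl (sym eq) (digit-<-mono B a' a h' h a'<B h'<h))

baseValue-injective : ∀ B d d' → length d ≡ length d' → All (_< B) d → All (_< B) d' →
  baseValue B d ≡ baseValue B d' → d ≡ d'
baseValue-injective B []      []        _   _        _          _  = refl
baseValue-injective B (a ∷ d) (a' ∷ d') len (p ∷ ps) (p' ∷ ps') eq
  with digit-injective B a a' (baseValue B d) (baseValue B d') p p' eq
... | a≡a' , rest = cong₂ _∷_ a≡a' (baseValue-injective B d d' (ℕP.suc-injective len) ps ps' rest)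

ifEq : ℕ → ℕ → ℚ → ℚ
ifEq e E c with e ℕ.≟ E
... | yes _ = c
... | no  _ = 0ℚ

ifEq-yes : ∀ {e E} c → e ≡ E → ifEq e E c ≡ c
ifEq-yes {e} {E} c eq with e ℕ.≟ E
... | yes _  = refl
... | no e≢E = ⊥-elim (e≢E eq)

ifEq-no : ∀ {e E} c → e ≢ E → ifEq e E c ≡ 0ℚ
ifEq-no {e} {E} c e≢E with e ℕ.≟ E
... | yes eq = ⊥-elim (e≢E eq)
... | no  _  = refl

ifEq-scale : ∀ e E c → ifEq e E c ≡ c * ifEq e E 1ℚ
ifEq-scale e E c with e ℕ.≟ E
... | yes _ = sym (ℚP.*-identityʳ c)
... | no  _ = sym (ℚP.*-zeroʳ c)

0≤ifEq : ∀ e E → 0ℚ ℚ.≤ ifEq e E 1ℚ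
0≤ifEq e E with e ℕ.≟ E
... | yes _ = ℚP.<⇒≤ (ℚP.positive⁻¹ 1ℚ)
... | no  _ = ℚP.≤-refl

module _ {A : Set} (value : A → ℕ) (E : ℕ) where

  count : List A → ℚ
  count as = sumℚ (map (λ a → ifEq (value a) E 1ℚ) as)

  0≤count : ∀ as → 0ℚ ℚ.≤ count as
  0≤count []       = ℚP.≤-refl
  0≤count (a ∷ as) = subst (ℚ._≤ count (a ∷ as)) (ℚP.+-identityˡ 0ℚ)
    (ℚP.+-mono-≤ (0≤ifEq (value a) E) (0≤count as))

  0<count : ∀ {a} as → a ∈ as → value a ≡ E → 0ℚ ℚ.< count as
  0<count (a ∷ as) (here refl) eq = subst (ℚ._< count (a ∷ as)) (ℚP.+-identityˡ 0ℚ)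
    (ℚP.+-mono-<-≤ (subst (0ℚ ℚ.<_) (sym (ifEq-yes 1ℚ eq)) (ℚP.positive⁻¹ 1ℚ)) (0≤count as))
  0<count (b ∷ as) (there m)   eq = subst (ℚ._< count (b ∷ as)) (ℚP.+-identityˡ 0ℚ)
    (ℚP.+-mono-≤-< (0≤ifEq (value b) E) (0<count as m eq))

-- A polynomial vanishing at every natural number
-- has only zero coefficients.  Dense polynomials are coefficient lists (lowest
-- degree first); the proof is by induction on the length, using the Taylor shift
-- p(y) ↦ p(y + 1) to move the roots 1, 2, 3, … of p(y) = a + y·q(y) back to 0, 1, 2, ….

eval : List ℚ → ℚ → ℚ
eval []      y = 0ℚ
eval (a ∷ p) y = a + y * eval p y

coeff : ℕ → List ℚ → ℚ
coeff _       []      = 0ℚ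
coeff zero    (a ∷ p) = a
coeff (suc i) (a ∷ p) = coeff i p

_⊕_ : List ℚ → List ℚ → List ℚ
[]      ⊕ q       = q
(a ∷ p) ⊕ []      = a ∷ p
(a ∷ p) ⊕ (b ∷ q) = (a + b) ∷ (p ⊕ q)

eval-⊕ : ∀ p q y → eval (p ⊕ q) y ≡ eval p y + eval q y
eval-⊕ []      q       y = sym (ℚP.+-identityˡ _)
eval-⊕ (a ∷ p) []      y = sym (ℚP.+-identityʳ _)
eval-⊕ (a ∷ p) (b ∷ q) y = begin
  (a + b) + y * eval (p ⊕ q) y        ≡⟨ cong (λ t → (a + b) + y * t) (eval-⊕ p q y) ⟩
  (a + b) + y * (eval p y + eval q y)
    ≡⟨ solve 5 (λ a b y u v → (a :+ b) :+ y :* (u :+ v) := (a :+ y :* u) :+ (b :+ y :* v))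
               refl a b y (eval p y) (eval q y) ⟩
  (a + y * eval p y) + (b + y * eval q y) ∎

coeff-⊕ : ∀ i p q → coeff i (p ⊕ q) ≡ coeff i p + coeff i q
coeff-⊕ i       []      q       = sym (ℚP.+-identityˡ _)
coeff-⊕ i       (a ∷ p) []      = sym (ℚP.+-identityʳ _)
coeff-⊕ zero    (a ∷ p) (b ∷ q) = refl
coeff-⊕ (suc i) (a ∷ p) (b ∷ q) = coeff-⊕ i p q

length-⊕ : ∀ {N} p q → length p ≤ N → length q ≤ N → length (p ⊕ q) ≤ N
length-⊕ []      q       _         h         = h
length-⊕ (a ∷ p) []      h         _         = h
length-⊕ (a ∷ p) (b ∷ q) (s≤s h₁) (s≤s h₂) = s≤s (length-⊕ p q h₁ h₂)

monomial : ℚ → ℕ → List ℚ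
monomial c zero    = c ∷ []
monomial c (suc e) = 0ℚ ∷ monomial c e

eval-monomial : ∀ c e y → eval (monomial c e) y ≡ c * y ^ℚ e
eval-monomial c zero    y =
  trans (cong (c +_) (ℚP.*-zeroʳ y)) (trans (ℚP.+-identityʳ c) (sym (ℚP.*-identityʳ c)))
eval-monomial c (suc e) y = begin
  0ℚ + y * eval (monomial c e) y  ≡⟨ ℚP.+-identityˡ _ ⟩
  y * eval (monomial c e) y       ≡⟨ cong (y *_) (eval-monomial c e y) ⟩
  y * (c * y ^ℚ e)                ≡⟨ solve 3 (λ y c t → y :* (c :* t) := c :* (y :* t)) refl y c (y ^ℚ e) ⟩
  c * (y * y ^ℚ e)                ∎

coeff-monomial : ∀ i c e → coeff i (monomial c e) ≡ ifEq e i c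
coeff-monomial zero    c zero    = refl
coeff-monomial (suc i) c zero    = sym (ifEq-no {0} {suc i} c (λ ()))
coeff-monomial zero    c (suc e) = sym (ifEq-no {suc e} {0} c (λ ()))
coeff-monomial (suc i) c (suc e) with e ℕ.≟ i
... | yes e≡i = trans (coeff-monomial i c e) (trans (ifEq-yes c e≡i) (sym (ifEq-yes c (cong suc e≡i))))
... | no  e≢i = trans (coeff-monomial i c e) (trans (ifEq-no c e≢i) (sym (ifEq-no c (e≢i ∘ ℕP.suc-injective))))

taylorShift : List ℚ → List ℚ
taylorShift []      = []
taylorShift (a ∷ q) = (a ∷ []) ⊕ ((0ℚ ∷ taylorShift q) ⊕ taylorShift q)

eval-taylorShift : ∀ p y → eval (taylorShift p) y ≡ eval p (y + 1ℚ)
eval-taylorShift []      y = refl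
eval-taylorShift (a ∷ q) y = begin
  eval ((a ∷ []) ⊕ ((0ℚ ∷ taylorShift q) ⊕ taylorShift q)) y
    ≡⟨ eval-⊕ (a ∷ []) ((0ℚ ∷ taylorShift q) ⊕ taylorShift q) y ⟩
  eval (a ∷ []) y + eval ((0ℚ ∷ taylorShift q) ⊕ taylorShift q) y
    ≡⟨ cong (eval (a ∷ []) y +_) (eval-⊕ (0ℚ ∷ taylorShift q) (taylorShift q) y) ⟩
  (a + y * 0ℚ) + ((0ℚ + y * r) + r)
    ≡⟨ solve 3 (λ a y r → (a :+ y :* con 0ℚ) :+ ((con 0ℚ :+ y :* r) :+ r) := a :+ (y :+ con 1ℚ) :* r)
               refl a y r ⟩
  a + (y + 1ℚ) * r
    ≡⟨ cong (λ t → a + (y + 1ℚ) * t) (eval-taylorShift q y) ⟩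
  a + (y + 1ℚ) * eval q (y + 1ℚ) ∎
  where r = eval (taylorShift q) y

length-taylorShift : ∀ p → length (taylorShift p) ≤ length p
length-taylorShift []      = z≤n
length-taylorShift (a ∷ q) = length-⊕ (a ∷ []) ((0ℚ ∷ taylorShift q) ⊕ taylorShift q) (s≤s z≤n)
  (length-⊕ (0ℚ ∷ taylorShift q) (taylorShift q) (s≤s (length-taylorShift q))
            (ℕP.m≤n⇒m≤1+n (length-taylorShift q)))

natℚ : ℕ → ℚ
natℚ zero    = 0ℚ
natℚ (suc m) = 1ℚ + natℚ m

0≤natℚ : ∀ m → 0ℚ ℚ.≤ natℚ m
0≤natℚ zero    = ℚP.≤-refl
0≤natℚ (suc m) = subst (ℚ._≤ natℚ (suc m)) (ℚP.+-identityˡ 0ℚ)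
  (ℚP.+-mono-≤ (ℚP.<⇒≤ (ℚP.positive⁻¹ 1ℚ)) (0≤natℚ m))

0<natℚ-suc : ∀ m → 0ℚ ℚ.< natℚ (suc m)
0<natℚ-suc m = subst (ℚ._< natℚ (suc m)) (ℚP.+-identityˡ 0ℚ)
  (ℚP.+-mono-<-≤ (ℚP.positive⁻¹ 1ℚ) (0≤natℚ m))

*-cancel-≢0 : ∀ x y → x ≢ 0ℚ → x * y ≡ 0ℚ → y ≡ 0ℚ
*-cancel-≢0 x y x≢0 xy≡0 = begin
  y                  ≡⟨ sym (ℚP.*-identityˡ y) ⟩
  1ℚ * y             ≡⟨ cong (_* y) (sym (ℚP.*-inverseˡ x)) ⟩
  (ℚ.1/ x * x) * y   ≡⟨ ℚP.*-assoc (ℚ.1/ x) x y ⟩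
  ℚ.1/ x * (x * y)   ≡⟨ cong (ℚ.1/ x *_) xy≡0 ⟩
  ℚ.1/ x * 0ℚ        ≡⟨ ℚP.*-zeroʳ (ℚ.1/ x) ⟩
  0ℚ                 ∎
  where instance _ = ℚ.≢-nonZero x≢0

ZeroCoeffs : List ℚ → Set
ZeroCoeffs = All (_≡ 0ℚ)

eval-zeroCoeffs : ∀ p y → ZeroCoeffs p → eval p y ≡ 0ℚ
eval-zeroCoeffs []      y []       = refl
eval-zeroCoeffs (a ∷ p) y (e ∷ es) =
  trans (cong₂ (λ u v → u + y * v) e (eval-zeroCoeffs p y es)) (trans (ℚP.+-identityˡ _) (ℚP.*-zeroʳ y))

coeff-zeroCoeffs : ∀ p i → ZeroCoeffs p → coeff i p ≡ 0ℚ
coeff-zeroCoeffs []      i       []       = refl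
coeff-zeroCoeffs (a ∷ p) zero    (e ∷ es) = e
coeff-zeroCoeffs (a ∷ p) (suc i) (e ∷ es) = coeff-zeroCoeffs p i es

VanishesOnℕ : List ℚ → Set
VanishesOnℕ p = ∀ m → eval p (natℚ m) ≡ 0ℚ

-- (the bound N on the length makes the induction structural, since the
-- Taylor shift is not a structural subterm)
vanishing⇒zeroCoeffs : ∀ N p → length p ≤ N → VanishesOnℕ p → ZeroCoeffs p
vanishing⇒zeroCoeffs N       []      _          _ = []
vanishing⇒zeroCoeffs (suc N) (a ∷ q) (s≤s len) h = a≡0 ∷ vanishing⇒zeroCoeffs N q len qVanishes
  where
  a≡0 : a ≡ 0ℚ
  a≡0 = trans (sym (trans (cong (a +_) (ℚP.*-zeroˡ (eval q 0ℚ))) (ℚP.+-identityʳ a))) (h 0)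
  qVanishes-suc : ∀ m → eval q (natℚ (suc m)) ≡ 0ℚ
  qVanishes-suc m = *-cancel-≢0 (natℚ (suc m)) _ (ℚP.<⇒≢ (0<natℚ-suc m) ∘ sym)
    (trans (sym (ℚP.+-identityˡ _)) (trans (cong (λ t → t + natℚ (suc m) * eval q (natℚ (suc m))) (sym a≡0)) (h (suc m))))
  -- hence its Taylor shift vanishes on ℕ and, being shorter, is zero
  shiftZero : ZeroCoeffs (taylorShift q)
  shiftZero = vanishing⇒zeroCoeffs N (taylorShift q) (ℕP.≤-trans (length-taylorShift q) len)
    (λ m → trans (eval-taylorShift q (natℚ m)) (trans (cong (eval q) (ℚP.+-comm (natℚ m) 1ℚ)) (qVanishes-suc m)))
  qVanishes : VanishesOnℕ q
  qVanishes zero    = begin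
    eval q 0ℚ                     ≡⟨ cong (eval q) (sym (ℚP.+-inverseˡ 1ℚ)) ⟩
    eval q (- 1ℚ + 1ℚ)            ≡⟨ sym (eval-taylorShift q (- 1ℚ)) ⟩
    eval (taylorShift q) (- 1ℚ)   ≡⟨ eval-zeroCoeffs (taylorShift q) (- 1ℚ) shiftZero ⟩
    0ℚ                            ∎
  qVanishes (suc m) = qVanishes-suc m

-- Sparse polynomials Σ c·y^e, as lists of pairs (c , e) with repeated exponents allowed.

evalSparse : List (ℚ × ℕ) → ℚ → ℚ
evalSparse P y = sumℚ (map (λ (c , e) → c * y ^ℚ e) P)

coeffSparse : ℕ → List (ℚ × ℕ) → ℚ
coeffSparse E P = sumℚ (map (λ (c , e) → ifEq e E c) P)

toDense : List (ℚ × ℕ) → List ℚ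
toDense []            = []
toDense ((c , e) ∷ P) = monomial c e ⊕ toDense P

eval-toDense : ∀ P y → eval (toDense P) y ≡ evalSparse P y
eval-toDense []            y = refl
eval-toDense ((c , e) ∷ P) y =
  trans (eval-⊕ (monomial c e) (toDense P) y) (cong₂ _+_ (eval-monomial c e y) (eval-toDense P y))

coeff-toDense : ∀ E P → coeff E (toDense P) ≡ coeffSparse E P
coeff-toDense E []            = refl
coeff-toDense E ((c , e) ∷ P) =
  trans (coeff-⊕ E (monomial c e) (toDense P)) (cong₂ _+_ (coeff-monomial E c e) (coeff-toDense E P))

sparse-coeff-zero : ∀ P → (∀ y → evalSparse P y ≡ 0ℚ) → ∀ E → coeffSparse E P ≡ 0ℚ
sparse-coeff-zero P h E = trans (sym (coeff-toDense E P))
  (coeff-zeroCoeffs (toDense P) E (vanishing⇒zeroCoeffs (length (toDense P)) (toDense P) ℕP.≤-refl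
     (λ m → trans (eval-toDense P (natℚ m)) (h (natℚ m)))))

Combination : Set
Combination = List (ℚ × List ℕ)

combineSurj : Combination → List ℚ → ℚ
combineSurj Q xs = sumℚ (map (λ (c , ν) → c * surj xs ν) Q)

hits : ℕ → ℕ → ℕ → List ℕ → ℚ
hits B D E ν = count (baseValue B) E (blockSums D ν)

kroneckerSparse : ℕ → ℕ → Combination → List (ℚ × ℕ)
kroneckerSparse B D Q = concatMap (λ (c , ν) → map (λ d → (c , baseValue B d)) (blockSums D ν)) Q

evalSparse-kronecker : ∀ B D Q y →
  evalSparse (kroneckerSparse B D Q) y ≡ combineSurj Q (kronecker B D y)
evalSparse-kronecker B D Q y = begin
  evalSparse (kroneckerSparse B D Q) y
    ≡⟨ sum-concatMap term (λ (c , ν) → map (λ d → (c , baseValue B d)) (blockSums D ν)) Q ⟩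
  sumℚ (map (λ (c , ν) → sumℚ (map term (map (λ d → (c , baseValue B d)) (blockSums D ν)))) Q)
    ≡⟨ sum-cong Q perPartition ⟩
  combineSurj Q (kronecker B D y) ∎
  where
  term : ℚ × ℕ → ℚ
  term (c , e) = c * y ^ℚ e
  perPartition : ∀ cν → sumℚ (map term (map (λ d → (proj₁ cν , baseValue B d)) (blockSums D (proj₂ cν))))
                        ≡ proj₁ cν * surj (kronecker B D y) (proj₂ cν)
  perPartition (c , ν) = begin
    sumℚ (map term (map (λ d → (c , baseValue B d)) (blockSums D ν)))
      ≡⟨ sum-map-∘ term (λ d → (c , baseValue B d)) (blockSums D ν) ⟩
    sumℚ (map (λ d → c * y ^ℚ baseValue B d) (blockSums D ν))
      ≡⟨ sum-scale c (λ d → y ^ℚ baseValue B d) (blockSums D ν) ⟩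
    c * sumℚ (map (λ d → y ^ℚ baseValue B d) (blockSums D ν))
      ≡⟨ cong (c *_) (sym (surj-kronecker B D y ν)) ⟩
    c * surj (kronecker B D y) ν ∎

coeffSparse-kronecker : ∀ B D Q E →
  coeffSparse E (kroneckerSparse B D Q) ≡ sumℚ (map (λ (c , ν) → c * hits B D E ν) Q)
coeffSparse-kronecker B D Q E = begin
  coeffSparse E (kroneckerSparse B D Q)
    ≡⟨ sum-concatMap term (λ (c , ν) → map (λ d → (c , baseValue B d)) (blockSums D ν)) Q ⟩
  sumℚ (map (λ (c , ν) → sumℚ (map term (map (λ d → (c , baseValue B d)) (blockSums D ν)))) Q)
    ≡⟨ sum-cong Q perPartition ⟩
  sumℚ (map (λ (c , ν) → c * hits B D E ν) Q) ∎
  where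
  term : ℚ × ℕ → ℚ
  term (c , e) = ifEq e E c
  perPartition : ∀ cν → sumℚ (map term (map (λ d → (proj₁ cν , baseValue B d)) (blockSums D (proj₂ cν))))
                        ≡ proj₁ cν * hits B D E (proj₂ cν)
  perPartition (c , ν) = begin
    sumℚ (map term (map (λ d → (c , baseValue B d)) (blockSums D ν)))
      ≡⟨ sum-map-∘ term (λ d → (c , baseValue B d)) (blockSums D ν) ⟩
    sumℚ (map (λ d → ifEq (baseValue B d) E c) (blockSums D ν))
      ≡⟨ sum-cong (blockSums D ν) (λ d → ifEq-scale (baseValue B d) E c) ⟩
    sumℚ (map (λ d → c * ifEq (baseValue B d) E 1ℚ) (blockSums D ν))
      ≡⟨ sum-scale c (λ d → ifEq (baseValue B d) E 1ℚ) (blockSums D ν) ⟩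
    c * hits B D E ν ∎

kronecker-coeffs-vanish : ∀ B D Q → (∀ y → combineSurj Q (kronecker B D y) ≡ 0ℚ) →
  ∀ E → sumℚ (map (λ (c , ν) → c * hits B D E ν) Q) ≡ 0ℚ
kronecker-coeffs-vanish B D Q h E =
  trans (sym (coeffSparse-kronecker B D Q E))
        (sparse-coeff-zero (kroneckerSparse B D Q) (λ y → trans (evalSparse-kronecker B D Q y) (h y)) E)

-- For a partition ℓ of k into D parts, read in base B = k + 1: the only partition ν
-- of k with at most D parts having an ordered partition into D blocks whose block
-- sums spell ℓ is ℓ itself — all blocks are singletons, the digits determine the
-- block sums, and both ν and ℓ are sorted.
hits-other : ∀ k ν ℓ → IsPartition k ν → IsPartition k ℓ → length ν ≤ length ℓ → ν ≢ ℓ →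
  hits (suc k) (length ℓ) (baseValue (suc k) ℓ) ν ≡ 0ℚ
hits-other k ν ℓ (Σν , _ , sortedν) (Σℓ , _ , sortedℓ) few ν≢ℓ =
  sum-zero _ (blockSums (length ℓ) ν) (All.map notℓ (blockSums-sound (length ℓ) ν))
  where
  ℓ-blocks : BlockSums (length ℓ) ℓ ℓ
  ℓ-blocks = All.lookup (blockSums-sound (length ℓ) ℓ) (blockSums-singletons ℓ)
  digits< : ∀ {D μ d} → sumℕ μ ≡ k → BlockSums D μ d → All (_< suc k) d
  digits< Σμ bs = All.map (λ h → s≤s (subst (_ ≤_) Σμ h)) (BlockSums-digits bs)
  notℓ : ∀ {d} → BlockSums (length ℓ) ν d → ifEq (baseValue (suc k) d) (baseValue (suc k) ℓ) 1ℚ ≡ 0ℚ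
  notℓ {d} bs = ifEq-no 1ℚ λ same →
    let d≡ℓ = baseValue-injective (suc k) d ℓ (BlockSums-length bs) (digits< Σν bs) (digits< Σℓ ℓ-blocks) same
    in ν≢ℓ (sorted-↭⇒≡ sortedν sortedℓ (subst (ν ↭_) d≡ℓ (BlockSums-↭ bs few)))

hits-self : ∀ B ℓ → 0ℚ ℚ.< hits B (length ℓ) (baseValue B ℓ) ℓ
hits-self B ℓ = 0<count (baseValue B) (baseValue B ℓ) (blockSums (length ℓ) ℓ) (blockSums-singletons ℓ) refl

sum-uniqueKey : ∀ {A K : Set} (key : A → K) (F : A → ℚ) (xs : List A) {b : A} →
  Unique (map key xs) → b ∈ xs → All (λ a → key a ≢ key b → F a ≡ 0ℚ) xs → sumℚ (map F xs) ≡ F b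
sum-uniqueKey key F (a ∷ xs) (a≢rest ∷ _) (here refl) (_ ∷ off) =
  trans (cong (F a +_) (sum-zero F xs (All.zipWith (λ (vanish , a≢) → vanish (a≢ ∘ sym)) (off , AllP.map⁻ a≢rest))))
        (ℚP.+-identityʳ (F a))
sum-uniqueKey key F (a ∷ xs) (a≢rest ∷ distinct) (there b∈xs) (vanish ∷ off) =
  trans (cong (_+ sumℚ (map F xs)) (vanish (All.lookup (AllP.map⁻ a≢rest) b∈xs)))
        (trans (ℚP.+-identityˡ _) (sum-uniqueKey key F xs distinct b∈xs off))

vec⇒list : ∀ {n} (P : List ℚ → Set) → ((A : Vec ℚ n) → P (toList A)) → ∀ L → length L ≡ n → P L
vec⇒list P h L refl = subst P (VecP.toList∘fromList L) (h (fromList L))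

module Bound (s k n : ℕ) (k≤n : k ≤ n) (Q : Combination)
             (parts : All (λ cl → IsPartition k (proj₂ cl)) Q) (keys : Unique (map proj₂ Q))
             (identity : ∀ L → length L ≡ n → powerSum k (subsetSums s L) ≡ evalQ Q L) where

  positive : ∀ ν → IsPartition k ν → All (1 ≤_) ν
  positive _ (_ , pos , _) = pos

  -- Δ over D > s of the variables (the other n - D set to 0) kills the left side of
  -- the identity and turns the right side into Σ_ν c_ν · surj(xs; ν).
  combination-vanishes : ∀ xs → s < length xs → length xs ≤ n → combineSurj Q xs ≡ 0ℚ
  combination-vanishes xs s<D D≤n = begin
    combineSurj Q xs
      ≡⟨ sum-congᴬ Q (All.map (λ {cl} part → cong (proj₁ cl *_) (sym (Δ-monomialAt xs (proj₂ cl) (positive (proj₂ cl) part)))) parts) ⟩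
    sumℚ (map (λ cl → proj₁ cl * Δ xs (monomialAt (proj₂ cl))) Q)
      ≡⟨ sum-cong Q (λ cl → sym (Δ-scale xs (proj₁ cl) (monomialAt (proj₂ cl)))) ⟩
    sumℚ (map (λ cl → Δ xs (λ L → proj₁ cl * monomialAt (proj₂ cl) L)) Q)
      ≡⟨ sym (Δ-sum xs (λ L cl → proj₁ cl * monomialAt (proj₂ cl) L) Q) ⟩
    Δ xs (evalQ Q)
      ≡⟨ Δ-cong xs _ _ padded ⟩
    Δ xs (λ L → powerSum k (subsetSums s (L ++ zeros)))
      ≡⟨ Δ-subsetSums xs s zeros (_^ℚ k) s<D ⟩
    0ℚ ∎
    where
    zeros = replicate (n ∸ length xs) 0ℚ
    padded : ∀ L → length L ≡ length xs → evalQ Q L ≡ powerSum k (subsetSums s (L ++ zeros))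
    padded L sameLength = begin
      evalQ Q L
        ≡⟨ sum-congᴬ Q (All.map (λ {cl} part → cong (proj₁ cl *_)
             (sym (monomialAt-++zeros (proj₂ cl) L (n ∸ length xs) (positive (proj₂ cl) part)))) parts) ⟩
      evalQ Q (L ++ zeros)
        ≡⟨ sym (identity (L ++ zeros) lengthN) ⟩
      powerSum k (subsetSums s (L ++ zeros)) ∎
      where
      lengthN : length (L ++ zeros) ≡ n
      lengthN = trans (ListP.length-++ L)
        (trans (cong₂ ℕ._+_ sameLength (ListP.length-replicate (n ∸ length xs))) (ℕP.m+[n∸m]≡n D≤n))

  NonzeroTermsAtMost : ℕ → Set
  NonzeroTermsAtMost N = All (λ cl → proj₁ cl ≢ 0ℚ → length (proj₂ cl) ≤ N) Q

  -- Main step: a term c·t_ℓ with c ≠ 0 and the largest number D of parts has D ≤ s.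
  -- Otherwise Δ over the Kronecker curve (y, y^B, …, y^{B^{D-1}}), B = k+1, vanishes,
  -- and its coefficient of y^E, E = ℓ read in base B, is c · hits ℓ with hits ℓ > 0.
  longest-term : ∀ {c ℓ} → (c , ℓ) ∈ Q → c ≢ 0ℚ → NonzeroTermsAtMost (length ℓ) → length ℓ ≤ s
  longest-term {c} {ℓ} c·ℓ∈Q c≢0 longest with length ℓ ℕ.≤? s
  ... | yes ℓ≤s = ℓ≤s
  ... | no  ℓ≰s = ⊥-elim (c≢0 c≡0)
    where
    D = length ℓ
    B = suc k
    E = baseValue B ℓ
    partℓ : IsPartition k ℓ
    partℓ = All.lookup parts c·ℓ∈Q
    D≤n : D ≤ n
    D≤n = ℕP.≤-trans (subst (D ≤_) (proj₁ partℓ) (length≤sum ℓ (positive ℓ partℓ))) k≤n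
    coefficient : sumℚ (map (λ cl → proj₁ cl * hits B D E (proj₂ cl)) Q) ≡ 0ℚ
    coefficient = kronecker-coeffs-vanish B D Q
      (λ y → combination-vanishes (kronecker B D y)
               (subst (s <_) (sym (kronecker-length B D y)) (ℕP.≰⇒> ℓ≰s))
               (subst (_≤ n) (sym (kronecker-length B D y)) D≤n)) E
    vanishesOff : ∀ {cl} → IsPartition k (proj₂ cl) × (proj₁ cl ≢ 0ℚ → length (proj₂ cl) ≤ D) →
      proj₂ cl ≢ ℓ → proj₁ cl * hits B D E (proj₂ cl) ≡ 0ℚ
    vanishesOff {c′ , ν} (part , bound) ν≢ℓ with c′ ℚP.≟ 0ℚ
    ... | yes refl  = ℚP.*-zeroˡ (hits B D E ν)
    ... | no  c′≢0 = trans (cong (c′ *_) (hits-other k ν ℓ part partℓ (bound c′≢0) ν≢ℓ)) (ℚP.*-zeroʳ c′)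
    onlyℓ : sumℚ (map (λ cl → proj₁ cl * hits B D E (proj₂ cl)) Q) ≡ c * hits B D E ℓ
    onlyℓ = sum-uniqueKey proj₂ _ Q keys c·ℓ∈Q (All.zipWith vanishesOff (parts , longest))
    c≡0 : c ≡ 0ℚ
    c≡0 = *-cancel-≢0 (hits B D E ℓ) c (ℚP.<⇒≢ (hits-self B ℓ) ∘ sym)
            (trans (ℚP.*-comm (hits B D E ℓ) c) (trans (sym onlyℓ) coefficient))

  -- Descending induction on a bound N for the number of parts of nonzero terms:
  -- terms with exactly N > s parts are excluded by the main step.
  nonzeroTerms-bounded : ∀ N → NonzeroTermsAtMost N → NonzeroTermsAtMost s
  nonzeroTerms-bounded zero atMost = All.map (λ bound nz → ℕP.≤-trans (bound nz) z≤n) atMost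
  nonzeroTerms-bounded (suc N) atMost with suc N ℕ.≤? s
  ... | yes N<s = All.map (λ bound nz → ℕP.≤-trans (bound nz) N<s) atMost
  ... | no  N≮s = nonzeroTerms-bounded N (All.tabulate shorter)
    where
    shorter : ∀ {cl} → cl ∈ Q → proj₁ cl ≢ 0ℚ → length (proj₂ cl) ≤ N
    shorter {c , ν} cν∈Q c≢0 = ℕP.≤-pred (ℕP.≤∧≢⇒< (All.lookup atMost cν∈Q c≢0) λ ν-top →
      N≮s (subst (_≤ s) ν-top (longest-term cν∈Q c≢0 (subst NonzeroTermsAtMost (sym ν-top) atMost))))

  nonzeroTerms-atMost-k : NonzeroTermsAtMost k
  nonzeroTerms-atMost-k =
    All.map (λ {cl} (Σν , pos , _) _ → subst (length (proj₂ cl) ≤_) Σν (length≤sum (proj₂ cl) pos)) parts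

corollary2p6 : (s k n : ℕ) → s ≤ n → k ≤ n →
    (Q : List (ℚ × List ℕ)) →
    All (λ cl → IsPartition k (proj₂ cl)) Q →
    Unique (map proj₂ Q) →
    ((A : Vec ℚ n) → powerSum k (subsetSums s (toList A)) ≡ evalQ Q (toList A)) →
    (c : ℚ) (λs : List ℕ) → (c , λs) ∈ Q → c ≢ 0ℚ → length λs ≤ s
corollary2p6 s k n _ k≤n Q parts keys identity c λs c·λs∈Q c≢0 =
  All.lookup (nonzeroTerms-bounded k nonzeroTerms-atMost-k) c·λs∈Q c≢0
  where
  open Bound s k n k≤n Q parts keys
    (vec⇒list (λ L → powerSum k (subsetSums s L) ≡ evalQ Q L) identity)
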